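{- Let $a\ge 1$ and $b\ge 0$ be integers, let $G$ be a simple $(a,b)$-graph, and let $M$ be a matching of $G$. Then the graph $G_M$ is a $(2a-1,b)$-graph, i.e. every subgraph $H$ of $G_M$ satisfies $|E(H)|\le (2a-1)|V(H)|-b$.
   Context: For integers $a\ge1$, $b\ge0$, a graph $G$ is an $(a,b)$-graph if every subgraph $G'$ of $G$ (including $G$ itself) satisfies $|E(G')|\le a|V(G')|-b$. For a matching $M$ of $G$, $G_M$ denotes the graph obtained from $G$ by contracting every edge of $M$ (deleting the edge and identifying its end-vertices); $G_M$ may have multiple edges (counted with multiplicity) but no loops. -}

module Defs where

open import Data.Nat using (ℕ; _+_; _*_; _≤_)
open import Data.Fin using (Fin; _<_)
open import Data.Fin.Subset using (Subset; _∈_; ∣_∣)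
open import Data.Product using (_×_; _,_; proj₁; proj₂; ∃; ∃-syntax; Σ-syntax)
open import Data.Sum using (_⊎_)
open import Data.List using (List; length; map; _++_)
open import Data.List.Relation.Unary.All using (All)
open import Data.List.Relation.Unary.Unique.Propositional using (Unique)
open import Data.List.Relation.Unary.AllPairs using (AllPairs)
open import Data.List.Relation.Binary.Sublist.Propositional using (_⊆_)
open import Data.List.Relation.Binary.Permutation.Propositional using (_↭_)
import Data.List.Membership.Propositional as LM
open import Relation.Binary.PropositionalEquality using (_≡_; _≢_)
open import Function.Definitions using (Surjective)
open import Function using (_⇔_)

Edge : ℕ → Set
Edge n = Fin n × Fin n

-- A finite multigraph: vertex set Fin V, edges a list (multiplicities = repetitions).
record Multigraph : Set where
  constructor mg
  field
    V : ℕ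
    E : List (Edge V)
open Multigraph public

-- A simple graph: each edge {u,v} is stored exactly once, as (u , v) with u < v
-- (so no loops, and no parallel edges).
record SimpleGraph (n : ℕ) : Set where
  constructor sg
  field
    edges   : List (Edge n)
    ordered : All (λ e → proj₁ e < proj₂ e) edges
    unique  : Unique edges
open SimpleGraph public

toMultigraph : ∀ {n} → SimpleGraph n → Multigraph
toMultigraph {n} G = mg n (edges G)

InSet : ∀ {n} → Subset n → Edge n → Set
InSet S e = proj₁ e ∈ S × proj₂ e ∈ S

-- (a,b)-graph: every (non-empty) subgraph G' = (S, E'), where S is a vertex set
-- and E' a sub-multiset of the edges with both end-vertices in S, satisfies
-- |E(G')| ≤ a |V(G')| - b   (written as |E(G')| + b ≤ a |V(G')| in ℕ).
IsABGraph : ℕ → ℕ → Multigraph → Set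
IsABGraph a b G =
  (S : Subset (V G)) → (∃[ x ] x ∈ S) →
  (E' : List (Edge (V G))) → E' ⊆ E G → All (InSet S) E' →
  length E' + b ≤ a * ∣ S ∣

Disjoint : ∀ {n} → Edge n → Edge n → Set
Disjoint (u , v) (x , y) = u ≢ x × u ≢ y × v ≢ x × v ≢ y

IsMatching : ∀ {n} → SimpleGraph n → List (Edge n) → Set
IsMatching G M = M ⊆ edges G × AllPairs Disjoint M

-- H is (isomorphic to) G_M: there is a surjective map φ from V(G) onto V(H)
-- identifying exactly the end-vertices of the edges of M, and the edges of H
-- are (as a multiset) the images under φ of the edges of G not in M.
IsContraction : ∀ {n} → SimpleGraph n → List (Edge n) → Multigraph → Set
IsContraction {n} G M H =
  Σ[ φ ∈ (Fin n → Fin (V H)) ]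
    Surjective _≡_ _≡_ φ ×
    (∀ u v → (φ u ≡ φ v) ⇔ (u ≡ v ⊎ (u , v) LM.∈ M ⊎ (v , u) LM.∈ M)) ×
    (Σ[ R ∈ List (Edge n) ]
        (edges G ↭ M ++ R) ×
        (E H ↭ map (λ e → φ (proj₁ e) , φ (proj₂ e)) R))

-- Let φ : V(G) → V(G_M) be the contraction, S' a vertex set of G_M spanning the edges E',
-- and S = φ⁻¹(S').  If k edges of M lie inside S, then φ identifies exactly their k pairs
-- of ends within S, so |S| ≤ |S'| + k, and k ≤ |S'| since distinct edges of a matching
-- have distinct images.  The edges in E' come from edges of G inside S not in M, so
--   |E'| + b ≤ a|S| - k ≤ a(|S'| + k) - k = a|S'| + (a-1)k ≤ (2a-1)|S'|.
module Submission where

open import Defs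
open import Data.Nat using (ℕ; suc; _+_; _*_; _∸_; _≤_; z≤n; s≤s)
open import Data.Nat.Properties using (+-monoˡ-≤; +-monoʳ-≤; *-monoʳ-≤; +-cancelʳ-≤; module ≤-Reasoning)
open import Data.Nat.Tactic.RingSolver using (solve-∀)
open import Data.Bool using (true; false)
open import Data.Fin using (Fin; zero; suc)
open import Data.Fin.Properties using (suc-injective; _≟_)
open import Data.Fin.Subset using (Subset; ∣_∣; inside; outside)
import Data.Fin.Subset as Subset
open import Data.Fin.Subset.Properties using (_∈?_)
open import Data.Vec using ([]; _∷_; here; there; tabulate; lookup)
open import Data.Vec.Properties using ([]=⇒lookup; lookup⇒[]=; lookup∘tabulate)
open import Data.List using (List; []; _∷_; _++_; map; filter; length)
open import Data.List.Properties using (length-map; length-++; length-++-sucʳ; filter-++; filter-all; filter-≐)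
open import Data.List.Relation.Unary.Any using (Any; here; there; any?)
open import Data.List.Relation.Unary.All as All using (All; []; _∷_)
open import Data.List.Relation.Unary.All.Properties using (all-filter)
open import Data.List.Relation.Unary.AllPairs as AllPairs using (AllPairs; []; _∷_)
open import Data.List.Relation.Unary.Unique.Propositional using (Unique)
import Data.List.Relation.Unary.Unique.Propositional.Properties as Unique
open import Data.List.Relation.Binary.Sublist.Propositional using (_⊆_)
open import Data.List.Relation.Binary.Sublist.Propositional.Properties using (filter⁺; filter-⊆; length-mono-≤)
open import Data.List.Relation.Binary.Permutation.Propositional using (_↭_)
open import Data.List.Relation.Binary.Permutation.Propositional.Properties using (↭-length; filter-↭)
open import Data.List.Membership.Propositional using (_∈_; find; lose)
open import Data.List.Membership.Propositional.Properties using (∈-∃++; ∈-map⁺; ∈-map⁻; ∈-++⁺ˡ; ∈-++⁺ʳ; ∈-filter⁺; ∈-filter⁻)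
open import Data.Product using (_×_; _,_; proj₁; proj₂; ∃)
open import Data.Sum using (_⊎_; inj₁; inj₂)
open import Data.Sum.Properties using (inj₁-injective; inj₂-injective)
open import Data.Empty using (⊥-elim)
open import Relation.Nullary using (¬_; Dec; yes; no; does)
open import Relation.Nullary.Decidable using (_×-dec_)
open import Relation.Unary using (Pred; Decidable)
open import Relation.Binary.PropositionalEquality using (_≡_; _≢_; refl; sym; trans; cong; cong₂; subst; module ≡-Reasoning)
open import Function using (_∘_; _⇔_; Equivalence)
open import Function.Definitions using (Surjective)

module _ {a} {A : Set a} where

  All⇒⊆-filter : ∀ {p} {P : Pred A p} (P? : Decidable P) {xs ys : List A} →
                 All P xs → xs ⊆ ys → xs ⊆ filter P? ys
  All⇒⊆-filter P? {ys = ys} all xs⊆ys =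
    subst (_⊆ filter P? ys) (filter-all P? all) (filter⁺ P? P? (λ { refl p → p }) xs⊆ys)

module _ {a b} {A : Set a} {B : Set b} where

  length-filter-map : ∀ {p} {P : Pred B p} (P? : Decidable P) (f : A → B) (xs : List A) →
                      length (filter P? (map f xs)) ≡ length (filter (P? ∘ f) xs)
  length-filter-map P? f [] = refl
  length-filter-map P? f (x ∷ xs) with does (P? (f x))
  ... | true  = cong suc (length-filter-map P? f xs)
  ... | false = length-filter-map P? f xs

  private
    ∈-++-∷⁻ : ∀ {y z : B} us vs → y ∈ us ++ z ∷ vs → y ≢ z → y ∈ us ++ vs
    ∈-++-∷⁻ []       vs (here y≡z) y≢z = ⊥-elim (y≢z y≡z)
    ∈-++-∷⁻ []       vs (there y∈) _   = y∈
    ∈-++-∷⁻ (u ∷ us) vs (here y≡u) _   = here y≡u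
    ∈-++-∷⁻ (u ∷ us) vs (there y∈) y≢z = there (∈-++-∷⁻ us vs y∈ y≢z)

  length-≤-injectiveOn : (f : A → B) (xs : List A) (ys : List B) → Unique xs →
    (∀ {x} → x ∈ xs → f x ∈ ys) →
    (∀ {x y} → x ∈ xs → y ∈ xs → f x ≡ f y → x ≡ y) →
    length xs ≤ length ys
  length-≤-injectiveOn f []       ys _            _    _   = z≤n
  length-≤-injectiveOn f (x ∷ xs) ys (x∉xs ∷ uxs) into inj with ∈-∃++ (into (here refl))
  ... | us , vs , refl = begin
      suc (length xs)         ≤⟨ s≤s (length-≤-injectiveOn f xs (us ++ vs) uxs into′ inj′) ⟩
      suc (length (us ++ vs)) ≡⟨ length-++-sucʳ us (f x) vs ⟨
      length (us ++ f x ∷ vs) ∎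
    where
      open ≤-Reasoning
      into′ : ∀ {y} → y ∈ xs → f y ∈ us ++ vs
      into′ y∈ = ∈-++-∷⁻ us vs (into (there y∈))
        (λ fy≡fx → All.lookup x∉xs y∈ (sym (inj (there y∈) (here refl) fy≡fx)))
      inj′ : ∀ {y z} → y ∈ xs → z ∈ xs → f y ≡ f z → y ≡ z
      inj′ y∈ z∈ = inj (there y∈) (there z∈)

elements : ∀ {n} → Subset n → List (Fin n)
elements []            = []
elements (inside  ∷ p) = zero ∷ map suc (elements p)
elements (outside ∷ p) = map suc (elements p)

length-elements : ∀ {n} (p : Subset n) → length (elements p) ≡ ∣ p ∣
length-elements []            = refl
length-elements (inside  ∷ p) = cong suc (trans (length-map suc (elements p)) (length-elements p))
length-elements (outside ∷ p) = trans (length-map suc (elements p)) (length-elements p)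

∈-elements⁺ : ∀ {n} {p : Subset n} {i} → i Subset.∈ p → i ∈ elements p
∈-elements⁺ {p = inside  ∷ p} here        = here refl
∈-elements⁺ {p = inside  ∷ p} (there i∈p) = there (∈-map⁺ suc (∈-elements⁺ i∈p))
∈-elements⁺ {p = outside ∷ p} (there i∈p) = ∈-map⁺ suc (∈-elements⁺ i∈p)

∈-elements⁻ : ∀ {n} {p : Subset n} {i} → i ∈ elements p → i Subset.∈ p
∈-elements⁻ {p = inside ∷ p} (here refl) = here
∈-elements⁻ {p = inside ∷ p} (there i∈) with ∈-map⁻ suc i∈
... | j , j∈ , refl = there (∈-elements⁻ j∈)
∈-elements⁻ {p = outside ∷ p} i∈ with ∈-map⁻ suc i∈
... | j , j∈ , refl = there (∈-elements⁻ j∈)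

elements-unique : ∀ {n} (p : Subset n) → Unique (elements p)
elements-unique []            = []
elements-unique (inside  ∷ p) =
  All.tabulate (zero≢ ∘ ∈-map⁻ suc) ∷ Unique.map⁺ suc-injective (elements-unique p)
  where
    zero≢ : ∀ {i} → ∃ (λ j → j ∈ elements p × i ≡ suc j) → zero ≢ i
    zero≢ (_ , _ , refl) ()
elements-unique (outside ∷ p) = Unique.map⁺ suc-injective (elements-unique p)

preimage : ∀ {m n} → (Fin m → Fin n) → Subset n → Subset m
preimage f p = tabulate (lookup p ∘ f)

module _ {m n} (f : Fin m → Fin n) (p : Subset n) where

  ∈-preimage⁺ : ∀ {i} → f i Subset.∈ p → i Subset.∈ preimage f p
  ∈-preimage⁺ {i} fi∈p = lookup⇒[]= i _ (trans (lookup∘tabulate (lookup p ∘ f) i) ([]=⇒lookup fi∈p))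

  ∈-preimage⁻ : ∀ {i} → i Subset.∈ preimage f p → f i Subset.∈ p
  ∈-preimage⁻ {i} i∈ = lookup⇒[]= (f i) p (trans (sym (lookup∘tabulate (lookup p ∘ f) i)) ([]=⇒lookup i∈))

inSet? : ∀ {n} (p : Subset n) → Decidable (InSet p)
inSet? p (u , v) = (u ∈? p) ×-dec (v ∈? p)

induced-subgraph-bound : ∀ {a b G} → IsABGraph a b G → (S : Subset (V G)) → ∃ (Subset._∈ S) →
  length (filter (inSet? S) (E G)) + b ≤ a * ∣ S ∣
induced-subgraph-bound {G = G} isAB S S-nonempty =
  isAB S S-nonempty (filter (inSet? S) (E G)) (filter-⊆ (inSet? S) (E G)) (all-filter (inSet? S) (E G))

mapEdge : ∀ {m n} → (Fin m → Fin n) → Edge m → Edge n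
mapEdge f (u , v) = f u , f v

_EndOf_ : ∀ {n} → Fin n → Edge n → Set
x EndOf (u , v) = x ≡ u ⊎ x ≡ v

Disjoint⇒¬sharedEnd : ∀ {n} {e e' : Edge n} {x} → Disjoint e e' → x EndOf e → ¬ x EndOf e'
Disjoint⇒¬sharedEnd (u≢x , _ , _ , _) (inj₁ refl) (inj₁ refl) = u≢x refl
Disjoint⇒¬sharedEnd (_ , u≢y , _ , _) (inj₁ refl) (inj₂ refl) = u≢y refl
Disjoint⇒¬sharedEnd (_ , _ , v≢x , _) (inj₂ refl) (inj₁ refl) = v≢x refl
Disjoint⇒¬sharedEnd (_ , _ , _ , v≢y) (inj₂ refl) (inj₂ refl) = v≢y refl

matching-sharedEnd⇒≡ : ∀ {n} {M : List (Edge n)} {e e' x} → AllPairs Disjoint M →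
  e ∈ M → e' ∈ M → x EndOf e → x EndOf e' → e ≡ e'
matching-sharedEnd⇒≡ _ (here refl) (here refl) _ _ = refl
matching-sharedEnd⇒≡ (d ∷ _) (here refl) (there e'∈) x∈e x∈e' =
  ⊥-elim (Disjoint⇒¬sharedEnd (All.lookup d e'∈) x∈e x∈e')
matching-sharedEnd⇒≡ (d ∷ _) (there e∈) (here refl) x∈e x∈e' =
  ⊥-elim (Disjoint⇒¬sharedEnd (All.lookup d e∈) x∈e' x∈e)
matching-sharedEnd⇒≡ (_ ∷ m) (there e∈) (there e'∈) = matching-sharedEnd⇒≡ m e∈ e'∈

matching-unique : ∀ {n} {M : List (Edge n)} → AllPairs Disjoint M → Unique M
matching-unique = AllPairs.map (λ d e≡e' → Disjoint⇒¬sharedEnd d (inj₁ refl) (inj₁ (cong proj₁ e≡e')))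

contracted-bound : ∀ c {b r k s s'} → k + r + b ≤ suc c * s → s ≤ s' + k → k ≤ s' →
                   r + b ≤ (2 * suc c ∸ 1) * s'
contracted-bound c {b} {r} {k} {s} {s'} edges vertices matched = +-cancelʳ-≤ k (r + b) _ (begin
  r + b + k                   ≡⟨ reorder r b k ⟩
  k + r + b                   ≤⟨ edges ⟩
  suc c * s                   ≤⟨ *-monoʳ-≤ (suc c) vertices ⟩
  suc c * (s' + k)            ≡⟨ expand c s' k ⟩
  suc c * s' + k + c * k      ≤⟨ +-monoʳ-≤ (suc c * s' + k) (*-monoʳ-≤ c matched) ⟩
  suc c * s' + k + c * s'     ≡⟨ collect c s' k ⟩
  (2 * suc c ∸ 1) * s' + k    ∎)
  where
    open ≤-Reasoning
    reorder : ∀ r b k → r + b + k ≡ k + r + b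
    reorder = solve-∀
    expand : ∀ c s' k → suc c * (s' + k) ≡ suc c * s' + k + c * k
    expand = solve-∀
    -- 2 * suc c ∸ 1 computes to c + (suc c + 0), a form the ring solver accepts
    collect : ∀ c s' k → suc c * s' + k + c * s' ≡ (c + (suc c + 0)) * s' + k
    collect = solve-∀

module Contraction {n m} {M : List (Edge n)} (matching : AllPairs Disjoint M)
  (φ : Fin n → Fin m)
  (merges : ∀ u v → (φ u ≡ φ v) ⇔ (u ≡ v ⊎ (u , v) ∈ M ⊎ (v , u) ∈ M))
  where

  private
    sharedEnd⇒≡ : ∀ {e e' x} → e ∈ M → e' ∈ M → x EndOf e → x EndOf e' → e ≡ e'
    sharedEnd⇒≡ = matching-sharedEnd⇒≡ matching

  φ∘proj₁-injectiveOn : ∀ {e e'} → e ∈ M → e' ∈ M → φ (proj₁ e) ≡ φ (proj₁ e') → e ≡ e'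
  φ∘proj₁-injectiveOn {u , _} {u' , _} e∈ e'∈ φu≡φu' with Equivalence.to (merges u u') φu≡φu'
  ... | inj₁ u≡u'        = sharedEnd⇒≡ e∈ e'∈ (inj₁ refl) (inj₁ u≡u')
  ... | inj₂ (inj₁ uu'∈) = trans (sharedEnd⇒≡ e∈ uu'∈ (inj₁ refl) (inj₁ refl))
                                 (sharedEnd⇒≡ uu'∈ e'∈ (inj₂ refl) (inj₁ refl))
  ... | inj₂ (inj₂ u'u∈) = trans (sharedEnd⇒≡ e∈ u'u∈ (inj₁ refl) (inj₂ refl))
                                 (sharedEnd⇒≡ u'u∈ e'∈ (inj₁ refl) (inj₁ refl))

  SecondEnd : Fin n → Set
  SecondEnd i = Any ((_≡ i) ∘ proj₂) M

  secondEnd? : Decidable SecondEnd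
  secondEnd? i = any? ((_≟ i) ∘ proj₂) M

  -- The injection behind |S| ≤ |S'| + k: the second end of a matching edge is sent to
  -- that edge, every other vertex to its image under φ.
  representative : ∀ i → Dec (SecondEnd i) → Fin m ⊎ Edge n
  representative i (yes p) = inj₂ (proj₁ (find p))
  representative i (no _)  = inj₁ (φ i)

  representative-injective : ∀ i j (di : Dec (SecondEnd i)) (dj : Dec (SecondEnd j)) →
    representative i di ≡ representative j dj → i ≡ j
  representative-injective i j (yes p) (yes q) eq with find p | find q
  ... | _ , _ , refl | _ , _ , refl = cong proj₂ (inj₂-injective eq)
  representative-injective i j (no ¬p) (no ¬q) eq with Equivalence.to (merges i j) (inj₁-injective eq)
  ... | inj₁ i≡j        = i≡j
  ... | inj₂ (inj₁ ij∈) = ⊥-elim (¬q (lose ij∈ refl))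
  ... | inj₂ (inj₂ ji∈) = ⊥-elim (¬p (lose ji∈ refl))

  module Preimage (S' : Subset m) where

    S : Subset n
    S = preimage φ S'

    matchedIn : List (Edge n)
    matchedIn = filter (inSet? S) M

    matchedIn-≤ : length matchedIn ≤ ∣ S' ∣
    matchedIn-≤ = begin
      length matchedIn      ≤⟨ length-≤-injectiveOn (φ ∘ proj₁) matchedIn (elements S')
                                 (Unique.filter⁺ (inSet? S) (matching-unique matching)) into inj ⟩
      length (elements S')  ≡⟨ length-elements S' ⟩
      ∣ S' ∣                ∎
      where
        open ≤-Reasoning
        into : ∀ {e} → e ∈ matchedIn → φ (proj₁ e) ∈ elements S'
        into e∈ = ∈-elements⁺ (∈-preimage⁻ φ S' (proj₁ (proj₂ (∈-filter⁻ (inSet? S) {xs = M} e∈))))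
        inj : ∀ {e e'} → e ∈ matchedIn → e' ∈ matchedIn → φ (proj₁ e) ≡ φ (proj₁ e') → e ≡ e'
        inj e∈ e'∈ = φ∘proj₁-injectiveOn (proj₁ (∈-filter⁻ (inSet? S) {xs = M} e∈))
                                         (proj₁ (∈-filter⁻ (inSet? S) {xs = M} e'∈))

    preimage-nonempty : Surjective _≡_ _≡_ φ → ∃ (Subset._∈ S') → ∃ (Subset._∈ S)
    preimage-nonempty surj (y , y∈S') with surj y
    ... | x , φx≡y = x , ∈-preimage⁺ φ S' (subst (Subset._∈ S') (sym (φx≡y refl)) y∈S')

    representatives : List (Fin m ⊎ Edge n)
    representatives = map inj₁ (elements S') ++ map inj₂ matchedIn

    representative-∈ : ∀ {i} → i Subset.∈ S → (d : Dec (SecondEnd i)) → representative i d ∈ representatives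
    representative-∈ i∈S (no _) = ∈-++⁺ˡ (∈-map⁺ inj₁ (∈-elements⁺ (∈-preimage⁻ φ S' i∈S)))
    representative-∈ {i} i∈S (yes p) with find p
    ... | (u , _) , ui∈M , refl =
      ∈-++⁺ʳ (map inj₁ (elements S')) (∈-map⁺ inj₂ (∈-filter⁺ (inSet? S) ui∈M (u∈S , i∈S)))
      where
        u∈S : u Subset.∈ S
        u∈S = ∈-preimage⁺ φ S' (subst (Subset._∈ S') (Equivalence.from (merges i u) (inj₂ (inj₂ ui∈M)))
                                      (∈-preimage⁻ φ S' i∈S))

    preimage-size : ∣ S ∣ ≤ ∣ S' ∣ + length matchedIn
    preimage-size = begin
      ∣ S ∣                   ≡⟨ length-elements S ⟨
      length (elements S)     ≤⟨ length-≤-injectiveOn (λ i → representative i (secondEnd? i))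
                                   (elements S) representatives (elements-unique S)
                                   (λ i∈ → representative-∈ (∈-elements⁻ i∈) (secondEnd? _))
                                   (λ _ _ → representative-injective _ _ (secondEnd? _) (secondEnd? _)) ⟩
      length representatives  ≡⟨ length-++ (map inj₁ (elements S')) ⟩
      length (map inj₁ (elements S')) + length (map inj₂ matchedIn)
        ≡⟨ cong₂ _+_ (trans (length-map inj₁ (elements S')) (length-elements S')) (length-map inj₂ matchedIn) ⟩
      ∣ S' ∣ + length matchedIn ∎
      where open ≤-Reasoning

    edges-in-preimage : ∀ {es R} → es ↭ M ++ R →
      length (filter (inSet? S) es) ≡ length matchedIn + length (filter (inSet? S) R)
    edges-in-preimage {es} {R} es↭M++R = begin
      length (filter (inSet? S) es)                   ≡⟨ ↭-length (filter-↭ (inSet? S) es↭M++R) ⟩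
      length (filter (inSet? S) (M ++ R))             ≡⟨ cong length (filter-++ (inSet? S) M R) ⟩
      length (matchedIn ++ filter (inSet? S) R)       ≡⟨ length-++ matchedIn ⟩
      length matchedIn + length (filter (inSet? S) R) ∎
      where open ≡-Reasoning

    edges-of-image : ∀ {R es E'} → es ↭ map (mapEdge φ) R → E' ⊆ es → All (InSet S') E' →
      length E' ≤ length (filter (inSet? S) R)
    edges-of-image {R} {es} {E'} es↭φR E'⊆es E'inS' = begin
      length E'                                       ≤⟨ length-mono-≤ (All⇒⊆-filter (inSet? S') E'inS' E'⊆es) ⟩
      length (filter (inSet? S') es)                  ≡⟨ ↭-length (filter-↭ (inSet? S') es↭φR) ⟩
      length (filter (inSet? S') (map (mapEdge φ) R)) ≡⟨ length-filter-map (inSet? S') (mapEdge φ) R ⟩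
      length (filter (inSet? S' ∘ mapEdge φ) R)       ≡⟨ cong length (filter-≐ _ (inSet? S) (toS , fromS) R) ⟩
      length (filter (inSet? S) R)                    ∎
      where
        open ≤-Reasoning
        toS : ∀ {e} → InSet S' (mapEdge φ e) → InSet S e
        toS (u∈ , v∈) = ∈-preimage⁺ φ S' u∈ , ∈-preimage⁺ φ S' v∈
        fromS : ∀ {e} → InSet S e → InSet S' (mapEdge φ e)
        fromS (u∈ , v∈) = ∈-preimage⁻ φ S' u∈ , ∈-preimage⁻ φ S' v∈

theorem7 : (a b : ℕ) → 1 ≤ a → (n : ℕ) (G : SimpleGraph n) →
    IsABGraph a b (toMultigraph G) →
    (M : List (Edge n)) → IsMatching G M →
    (H : Multigraph) → IsContraction G M H →
    IsABGraph (2 * a ∸ 1) b H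
theorem7 (suc c) b _ n G isAB M (_ , matching) H (φ , surj , merges , R , G↭M++R , H↭φR)
         S' S'-nonempty E' E'⊆ E'inS' = begin
  length E' + b                     ≤⟨ +-monoˡ-≤ b (edges-of-image H↭φR E'⊆ E'inS') ⟩
  length (filter (inSet? S) R) + b  ≤⟨ contracted-bound c edges-in-S preimage-size matchedIn-≤ ⟩
  (2 * suc c ∸ 1) * ∣ S' ∣          ∎
  where
    open ≤-Reasoning
    open Contraction matching φ merges
    open Preimage S'
    edges-in-S : length matchedIn + length (filter (inSet? S) R) + b ≤ suc c * ∣ S ∣
    edges-in-S = subst (λ k → k + b ≤ suc c * ∣ S ∣) (edges-in-preimage G↭M++R)
                       (induced-subgraph-bound {a = suc c} isAB S (preimage-nonempty surj S'-nonempty))
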